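{- Let $t,u$ be checkers terms, $x$ a variable, $M$ a multi type and $T$ a linear or multi type. If $\mathcal{D}$ is a derivation of $\Gamma,x:M\vdash^kt:T$ and $\mathcal{E}$ is a derivation of $\Delta\vdash^{k'}u:M$, then there exists a derivation $\mathcal{D}'$ of $\Gamma+\Delta\vdash^{k+k'}t\{x:=u\}:T$ with $|\mathcal{D}'|=|\mathcal{D}|+|\mathcal{E}|$.
   Context: Checkers terms: $t ::= x\mid\lambda_cx.t\mid t\cdot^cu$, $c\in\{\circ,\bullet\}$, modulo $\alpha$; $t\{x:=u\}$ is capture-avoiding substitution. Types: linear $L ::= X\mid M\to_cL$; multi $M ::= [L_1,\ldots,L_n]$ (finite multisets); environments $\Gamma$ (finite support), pointwise $+$, $\Gamma,x:M$ extends $\Gamma$ with $x\notin\mathrm{supp}(\Gamma)$. Rules: (ax) $x:[L]\vdash^0x:L$; (many) from $\Gamma_i\vdash^{k_i}t:L_i$ ($i\in I$ finite, possibly empty) infer $\sum\Gamma_i\vdash^{\sum k_i}t:[L_i]_{i\in I}$; ($\lambda$) from $\Gamma,x:M\vdash^kt:L$ infer $\Gamma\vdash^k\lambda_cx.t:M\to_cL$; (@) from $\Gamma\vdash^{k_1}t:M\to_cL$ and $\Delta\vdash^{k_2}u:M$ infer $\Gamma+\Delta\vdash^kt\cdot^du:L$, $k=k_1+k_2$ if $c=d$, else $k_1+k_2+1$. The applicative size $|\mathcal{D}|$ of a derivation is the number of (@) rules in it. -}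

module Defs where

open import Data.Nat using (ℕ; zero; suc; _+_)
open import Data.Fin using (Fin; zero; suc; punchOut)
open import Data.Fin.Properties using (_≟_)
open import Data.List using (List; []; _∷_; _++_)
open import Data.List.Relation.Binary.Permutation.Propositional using (_↭_)
import Data.List.Relation.Binary.Pointwise as LP
open import Data.Vec using (Vec; []; _∷_; replicate; zipWith; insertAt; updateAt)
import Data.Vec.Relation.Binary.Pointwise.Inductive as VP
open import Relation.Nullary using (yes; no)

-- Checkers terms, scoped de Bruijn (terms modulo α); Term n has free
-- variables among Fin n.

data Color : Set where
  ∘ ● : Color

data Term (n : ℕ) : Set where
  var  : Fin n → Term n
  lam  : Color → Term (suc n) → Term n
  app  : Term n → Color → Term n → Term n

ext : ∀ {m n} → (Fin m → Fin n) → Fin (suc m) → Fin (suc n)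
ext ρ zero    = zero
ext ρ (suc i) = suc (ρ i)

rename : ∀ {m n} → (Fin m → Fin n) → Term m → Term n
rename ρ (var i)     = var (ρ i)
rename ρ (lam c t)   = lam c (rename (ext ρ) t)
rename ρ (app t c u) = app (rename ρ t) c (rename ρ u)

exts : ∀ {m n} → (Fin m → Term n) → Fin (suc m) → Term (suc n)
exts σ zero    = var zero
exts σ (suc i) = rename suc (σ i)

subst : ∀ {m n} → (Fin m → Term n) → Term m → Term n
subst σ (var i)     = σ i
subst σ (lam c t)   = lam c (subst (exts σ) t)
subst σ (app t c u) = app (subst σ t) c (subst σ u)

single : ∀ {n} → Fin (suc n) → Term n → Fin (suc n) → Term n
single x u y with x ≟ y
... | yes _  = u
... | no x≢y = var (punchOut x≢y)

_[_:=_] : ∀ {n} → Term (suc n) → Fin (suc n) → Term n → Term n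
t [ x := u ] = subst (single x u) t

-- Types.  Multisets are represented by lists, identified up to the
-- equivalence ≈M below (permutation, recursively up to ≈L).

data Lin : Set where
  tvar   : ℕ → Lin
  _⇒[_]_ : List Lin → Color → Lin → Lin

Multi : Set
Multi = List Lin

mutual
  data _≈L_ : Lin → Lin → Set where
    var≈ : ∀ {X} → tvar X ≈L tvar X
    arr≈ : ∀ {M M' c L L'} → M ≈M M' → L ≈L L' → (M ⇒[ c ] L) ≈L (M' ⇒[ c ] L')

  data _≈M_ : Multi → Multi → Set where
    perm≈ : ∀ {M N M'} → M ↭ N → LP.Pointwise _≈L_ N M' → M ≈M M'

data Ty : Set where
  lin   : Lin → Ty
  multi : Multi → Ty

-- Environments over the variables Fin n (finite support automatically)

Env : ℕ → Set
Env n = Vec Multi n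

_≈E_ : ∀ {n} → Env n → Env n → Set
_≈E_ = VP.Pointwise _≈M_

emptyEnv : ∀ {n} → Env n
emptyEnv = replicate _ []

_+E_ : ∀ {n} → Env n → Env n → Env n
_+E_ = zipWith _++_

oneEnv : ∀ {n} → Fin n → Multi → Env n
oneEnv x M = updateAt emptyEnv x (λ _ → M)

-- Γ , x : M  (x is a fresh variable inserted at position x)
_,[_]∶_ : ∀ {n} → Env n → Fin (suc n) → Multi → Env (suc n)
Γ ,[ x ]∶ M = insertAt Γ x M

cost : Color → Color → ℕ → ℕ → ℕ
cost ∘ ∘ k₁ k₂ = k₁ + k₂
cost ● ● k₁ k₂ = k₁ + k₂
cost ∘ ● k₁ k₂ = suc (k₁ + k₂)
cost ● ∘ k₁ k₂ = suc (k₁ + k₂)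

-- Every rule's conclusion is taken
-- modulo multiset equality (≈E on environments, ≈L on types), so that
-- judgments are about multisets as in the paper.  The finite family of
-- premises of (many) is given as a list (many[] / many∷).

data _⊢[_]_∶_ {n : ℕ} : Env n → ℕ → Term n → Ty → Set where
  ax    : ∀ {Γ x L L'} → Γ ≈E oneEnv x (L ∷ []) → L' ≈L L →
          Γ ⊢[ 0 ] var x ∶ lin L'
  many[] : ∀ {Γ t} → Γ ≈E emptyEnv → Γ ⊢[ 0 ] t ∶ multi []
  many∷ : ∀ {Γ Γ₁ Γ₂ k₁ k₂ t L M N} →
          Γ₁ ⊢[ k₁ ] t ∶ lin L → Γ₂ ⊢[ k₂ ] t ∶ multi M →
          Γ ≈E (Γ₁ +E Γ₂) → N ≈M (L ∷ M) →
          Γ ⊢[ k₁ + k₂ ] t ∶ multi N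
  lamR  : ∀ {Γ M k c t L L'} →
          (M ∷ Γ) ⊢[ k ] t ∶ lin L → L' ≈L (M ⇒[ c ] L) →
          Γ ⊢[ k ] lam c t ∶ lin L'
  appR  : ∀ {Γ Γ₁ Γ₂ k₁ k₂ t u c d M L L'} →
          Γ₁ ⊢[ k₁ ] t ∶ lin (M ⇒[ c ] L) → Γ₂ ⊢[ k₂ ] u ∶ multi M →
          Γ ≈E (Γ₁ +E Γ₂) → L' ≈L L →
          Γ ⊢[ cost c d k₁ k₂ ] app t d u ∶ lin L'

size : ∀ {n} {Γ : Env n} {k t T} → Γ ⊢[ k ] t ∶ T → ℕ
size (ax _ _)           = 0
size (many[] _)         = 0
size (many∷ D E _ _)    = size D + size E
size (lamR D _)         = size D
size (appR D E _ _)     = suc (size D + size E)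

-- Induction on the derivation of t, generalised to an arbitrary position x of an arbitrary
-- environment and to an exact list of linear derivations of u, one for each type in the
-- multiset of x.  A binary rule splits the multiset of x, and with it that list, between its
-- premises; an axiom on x consumes the single derivation left, any other axiom none; under a
-- λ the derivations of u are weakened.  Each linear derivation of u is used exactly once,
-- which is why environments, counters and applicative sizes simply add up.
module Submission where

open import Defs
open import Algebra.Bundles using (CommutativeMonoid)
open import Algebra.Structures using (IsCommutativeMonoid)
import Algebra.Properties.CommutativeSemigroup as CommutativeSemigroupProperties
open import Data.Fin using (Fin; zero; suc; punchIn; punchOut)
open import Data.Fin.Properties using (_≟_; punchOut-cong)
open import Data.List using (List; []; _∷_; _++_)
import Data.List.Properties as List
open import Data.List.Relation.Binary.Permutation.Propositional
  using (_↭_; refl; prep; swap; trans; ↭-sym)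
import Data.List.Relation.Binary.Permutation.Propositional.Properties as ↭
import Data.List.Relation.Binary.Pointwise as ListPW
open ListPW using ([]; _∷_)
open import Data.Nat using (ℕ; suc; _+_)
open import Data.Nat.Properties using (+-identityʳ; +-assoc; +-commutativeSemigroup)
open import Data.Product using (Σ; ∃; _×_; _,_)
open import Data.Vec
  using (Vec; []; _∷_; replicate; zipWith; insertAt; removeAt; updateAt; lookup)
import Data.Vec.Properties as Vec
import Data.Vec.Relation.Binary.Pointwise.Inductive as VecPW
open VecPW using ([]; _∷_)
open import Function using (flip; _∘′_)
open import Relation.Binary.Structures using (IsEquivalence)
open import Relation.Binary.PropositionalEquality as ≡
  using (_≡_; _≢_; _≗_; refl; cong; cong₂)
open import Relation.Nullary using (yes; no; contradiction)

Pointwise-↭-commute : ∀ {a b r} {A : Set a} {B : Set b} {R : A → B → Set r} {xs ys xs′} →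
  ListPW.Pointwise R xs ys → xs ↭ xs′ → ∃ λ ys′ → ys ↭ ys′ × ListPW.Pointwise R xs′ ys′
Pointwise-↭-commute xs∼ys refl = _ , refl , xs∼ys
Pointwise-↭-commute (x∼y ∷ xs∼ys) (prep _ p) with Pointwise-↭-commute xs∼ys p
... | _ , q , xs′∼ys′ = _ , prep _ q , x∼y ∷ xs′∼ys′
Pointwise-↭-commute (x∼y ∷ x′∼y′ ∷ xs∼ys) (swap _ _ p) with Pointwise-↭-commute xs∼ys p
... | _ , q , xs′∼ys′ = _ , swap _ _ q , x′∼y′ ∷ x∼y ∷ xs′∼ys′
Pointwise-↭-commute xs∼ys (trans p p′) with Pointwise-↭-commute xs∼ys p
... | _ , q , xs₁∼ys₁ with Pointwise-↭-commute xs₁∼ys₁ p′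
... | _ , q′ , xs₂∼ys₂ = _ , trans q q′ , xs₂∼ys₂

Pointwise-↭-commute˘ : ∀ {a b r} {A : Set a} {B : Set b} {R : A → B → Set r} {xs ys ys′} →
  ListPW.Pointwise R xs ys → ys ↭ ys′ → ∃ λ xs′ → xs ↭ xs′ × ListPW.Pointwise R xs′ ys′
Pointwise-↭-commute˘ {R = R} xs∼ys p
  with Pointwise-↭-commute (ListPW.symmetric {R = R} {S = flip R} (λ r → r) xs∼ys) p
... | _ , q , ys′∼xs′ = _ , q , ListPW.symmetric {R = flip R} {S = R} (λ r → r) ys′∼xs′

_≈*_ : List Lin → List Lin → Set
_≈*_ = ListPW.Pointwise _≈L_

mutual
  ≈L-refl : ∀ {L} → L ≈L L
  ≈L-refl {tvar X}     = var≈
  ≈L-refl {M ⇒[ c ] L} = arr≈ ≈M-refl ≈L-refl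

  ≈M-refl : ∀ {M} → M ≈M M
  ≈M-refl = perm≈ refl ≈*-refl

  ≈*-refl : ∀ {M} → M ≈* M
  ≈*-refl {[]}    = []
  ≈*-refl {L ∷ M} = ≈L-refl ∷ ≈*-refl

mutual
  ≈L-sym : ∀ {L L′} → L ≈L L′ → L′ ≈L L
  ≈L-sym var≈       = var≈
  ≈L-sym (arr≈ m l) = arr≈ (≈M-sym m) (≈L-sym l)

  ≈M-sym : ∀ {M M′} → M ≈M M′ → M′ ≈M M
  ≈M-sym (perm≈ p q) with Pointwise-↭-commute q (↭-sym p)
  ... | _ , r , s = perm≈ r (≈*-sym s)

  ≈*-sym : ∀ {M M′} → M ≈* M′ → M′ ≈* M
  ≈*-sym []      = []
  ≈*-sym (l ∷ q) = ≈L-sym l ∷ ≈*-sym q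

mutual
  ≈L-trans : ∀ {L L′ L″} → L ≈L L′ → L′ ≈L L″ → L ≈L L″
  ≈L-trans var≈       var≈         = var≈
  ≈L-trans (arr≈ m l) (arr≈ m′ l′) = arr≈ (≈M-trans m m′) (≈L-trans l l′)

  ≈M-trans : ∀ {M M′ M″} → M ≈M M′ → M′ ≈M M″ → M ≈M M″
  ≈M-trans (perm≈ p q) (perm≈ p′ q′) with Pointwise-↭-commute˘ q p′
  ... | _ , r , s = perm≈ (trans p r) (≈*-trans s q′)

  ≈*-trans : ∀ {M M′ M″} → M ≈* M′ → M′ ≈* M″ → M ≈* M″
  ≈*-trans []      []        = []
  ≈*-trans (l ∷ q) (l′ ∷ q′) = ≈L-trans l l′ ∷ ≈*-trans q q′

≈M-isEquivalence : IsEquivalence _≈M_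
≈M-isEquivalence = record { refl = ≈M-refl ; sym = ≈M-sym ; trans = ≈M-trans }

≈M-reflexive : ∀ {M N} → M ≡ N → M ≈M N
≈M-reflexive refl = ≈M-refl

++-isCommutativeMonoid : IsCommutativeMonoid _≈M_ _++_ []
++-isCommutativeMonoid = record
  { isMonoid = record
    { isSemigroup = record
      { isMagma = record
        { isEquivalence = ≈M-isEquivalence
        ; ∙-cong = λ { (perm≈ p q) (perm≈ p′ q′) → perm≈ (↭.++⁺ p p′) (ListPW.++⁺ q q′) }
        }
      ; assoc = λ M N P → ≈M-reflexive (List.++-assoc M N P)
      }
    ; identity = (λ M → ≈M-refl) , (λ M → ≈M-reflexive (List.++-identityʳ M))
    }
  ; comm = λ M N → perm≈ (↭.++-comm M N) ≈*-refl
  }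

+E-commutativeMonoid : ℕ → CommutativeMonoid _ _
+E-commutativeMonoid n = record
  { Carrier = Env n ; _≈_ = _≈E_ ; _∙_ = _+E_ ; ε = emptyEnv
  ; isCommutativeMonoid = record
    { isMonoid = record
      { isSemigroup = record
        { isMagma = record
          { isEquivalence = VecPW.isEquivalence isEquivalence n
          ; ∙-cong = VecPW.zipWith-cong ∙-cong
          }
        ; assoc = VecPW.zipWith-assoc assoc
        }
      ; identity = VecPW.zipWith-identityˡ identityˡ , VecPW.zipWith-identityʳ identityʳ
      }
    ; comm = VecPW.zipWith-comm comm
    }
  }
  where open IsCommutativeMonoid ++-isCommutativeMonoid

module +E {n : ℕ} where
  open CommutativeMonoid (+E-commutativeMonoid n) public
  open CommutativeSemigroupProperties commutativeSemigroup public
    using (interchange; x∙yz≈y∙xz)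

module ℕ+ = CommutativeSemigroupProperties +-commutativeSemigroup

module _ {a} {A : Set a} where

  removeAt-zipWith : ∀ {n} (f : A → A → A) (xs ys : Vec A (suc n)) i →
    removeAt (zipWith f xs ys) i ≡ zipWith f (removeAt xs i) (removeAt ys i)
  removeAt-zipWith f (x ∷ xs)      (y ∷ ys)      zero    = refl
  removeAt-zipWith f (x ∷ x′ ∷ xs) (y ∷ y′ ∷ ys) (suc i) =
    cong (f x y ∷_) (removeAt-zipWith f (x′ ∷ xs) (y′ ∷ ys) i)

  removeAt-replicate : ∀ {n} (v : A) (i : Fin (suc n)) →
    removeAt (replicate (suc n) v) i ≡ replicate n v
  removeAt-replicate         v zero    = refl
  removeAt-replicate {suc n} v (suc i) = cong (v ∷_) (removeAt-replicate v i)

  removeAt-updateAt : ∀ {n} (xs : Vec A (suc n)) i {f : A → A} →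
    removeAt (updateAt xs i f) i ≡ removeAt xs i
  removeAt-updateAt (x ∷ xs)      zero          = refl
  removeAt-updateAt (x ∷ x′ ∷ xs) (suc zero)    = refl
  removeAt-updateAt (x ∷ x′ ∷ xs) (suc (suc i)) = cong (x ∷_) (removeAt-updateAt (x′ ∷ xs) (suc i))

  removeAt-updateAt′ : ∀ {n} (xs : Vec A (suc n)) {i j} (i≢j : i ≢ j) {f : A → A} →
    removeAt (updateAt xs j f) i ≡ updateAt (removeAt xs i) (punchOut i≢j) f
  removeAt-updateAt′ (x ∷ xs)      {zero}  {zero}        i≢j = contradiction refl i≢j
  removeAt-updateAt′ (x ∷ xs)      {zero}  {suc j}       i≢j = refl
  removeAt-updateAt′ (x ∷ x′ ∷ xs) {suc i} {zero}        i≢j = refl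
  removeAt-updateAt′ (x ∷ x′ ∷ xs) {suc i} {suc zero}    i≢j =
    cong (x ∷_) (removeAt-updateAt′ (x′ ∷ xs) (λ i≡j → i≢j (cong suc i≡j)))
  removeAt-updateAt′ (x ∷ x′ ∷ xs) {suc i} {suc (suc j)} i≢j =
    cong (x ∷_) (removeAt-updateAt′ (x′ ∷ xs) (λ i≡j → i≢j (cong suc i≡j)))

  insertAt-zipWith : ∀ {n} (f : A → A → A) (xs ys : Vec A n) i v w →
    insertAt (zipWith f xs ys) i (f v w) ≡ zipWith f (insertAt xs i v) (insertAt ys i w)
  insertAt-zipWith f xs       ys       zero    v w = refl
  insertAt-zipWith f (x ∷ xs) (y ∷ ys) (suc i) v w =
    cong (f x y ∷_) (insertAt-zipWith f xs ys i v w)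

  insertAt-replicate : ∀ {n} (v : A) (i : Fin (suc n)) →
    insertAt (replicate n v) i v ≡ replicate (suc n) v
  insertAt-replicate         v zero    = refl
  insertAt-replicate {suc n} v (suc i) = cong (v ∷_) (insertAt-replicate v i)

  insertAt-updateAt : ∀ {n} (xs : Vec A n) i j v {f : A → A} →
    insertAt (updateAt xs j f) i v ≡ updateAt (insertAt xs i v) (punchIn i j) f
  insertAt-updateAt xs       zero    j       v = refl
  insertAt-updateAt (x ∷ xs) (suc i) zero    v = refl
  insertAt-updateAt (x ∷ xs) (suc i) (suc j) v = cong (x ∷_) (insertAt-updateAt xs i j v)

module _ {a ℓ} {A : Set a} {R : A → A → Set ℓ} where

  removeAt⁺ : ∀ {n} {xs ys : Vec A (suc n)} i →
    VecPW.Pointwise R xs ys → VecPW.Pointwise R (removeAt xs i) (removeAt ys i)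
  removeAt⁺ zero    (_ ∷ xs∼ys)             = xs∼ys
  removeAt⁺ (suc i) (x∼y ∷ x′∼y′ ∷ xs∼ys) = x∼y ∷ removeAt⁺ i (x′∼y′ ∷ xs∼ys)

  insertAt⁺ : ∀ {n} {xs ys : Vec A n} i {v w} →
    R v w → VecPW.Pointwise R xs ys → VecPW.Pointwise R (insertAt xs i v) (insertAt ys i w)
  insertAt⁺ zero    v∼w xs∼ys         = v∼w ∷ xs∼ys
  insertAt⁺ (suc i) v∼w (x∼y ∷ xs∼ys) = x∼y ∷ insertAt⁺ i v∼w xs∼ys

module _ {n : ℕ} where

  lookup-emptyEnv : ∀ (x : Fin n) → lookup emptyEnv x ≡ []
  lookup-emptyEnv x = Vec.lookup-replicate x []

  lookup-oneEnv : ∀ (x : Fin n) M → lookup (oneEnv x M) x ≡ M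
  lookup-oneEnv x M = Vec.lookup∘updateAt x emptyEnv

  lookup-oneEnv′ : ∀ {x y : Fin n} M → x ≢ y → lookup (oneEnv y M) x ≡ []
  lookup-oneEnv′ {x} {y} M x≢y = ≡.trans (Vec.lookup∘updateAt′ x y x≢y emptyEnv) (lookup-emptyEnv x)

  removeAt-emptyEnv : ∀ (x : Fin (suc n)) → removeAt emptyEnv x ≡ emptyEnv
  removeAt-emptyEnv = removeAt-replicate []

  removeAt-oneEnv : ∀ (x : Fin (suc n)) M → removeAt (oneEnv x M) x ≡ emptyEnv
  removeAt-oneEnv x M = ≡.trans (removeAt-updateAt emptyEnv x) (removeAt-emptyEnv x)

  removeAt-oneEnv′ : ∀ {x y : Fin (suc n)} M (x≢y : x ≢ y) →
    removeAt (oneEnv y M) x ≡ oneEnv (punchOut x≢y) M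
  removeAt-oneEnv′ {x} M x≢y = ≡.trans (removeAt-updateAt′ emptyEnv x≢y)
    (cong (λ Γ → updateAt Γ (punchOut x≢y) (λ _ → M)) (removeAt-emptyEnv x))

  insertAt-emptyEnv : ∀ (i : Fin (suc n)) → insertAt emptyEnv i [] ≡ emptyEnv
  insertAt-emptyEnv = insertAt-replicate []

  insertAt-oneEnv : ∀ (i : Fin (suc n)) (y : Fin n) M →
    insertAt (oneEnv y M) i [] ≡ oneEnv (punchIn i y) M
  insertAt-oneEnv i y M = ≡.trans (insertAt-updateAt emptyEnv i y [])
    (cong (λ Γ → updateAt Γ (punchIn i y) (λ _ → M)) (insertAt-emptyEnv i))

  insertAt-[]-cong : ∀ (i : Fin (suc n)) {Γ Γ′ Γ″} →
    Γ ≈E Γ′ → insertAt Γ′ i [] ≡ Γ″ → insertAt Γ i [] ≈E Γ″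
  insertAt-[]-cong i Γ≈ refl = insertAt⁺ i ≈M-refl Γ≈

  insertAt-+E : ∀ (i : Fin (suc n)) {Γ} Γ₁ Γ₂ → Γ ≈E (Γ₁ +E Γ₂) →
    insertAt Γ i [] ≈E (insertAt Γ₁ i [] +E insertAt Γ₂ i [])
  insertAt-+E i Γ₁ Γ₂ Γ≈ = insertAt-[]-cong i Γ≈ (insertAt-zipWith _++_ Γ₁ Γ₂ i [] [])

  removeAt-+E-cong : ∀ (x : Fin (suc n)) {Γ Γ′ Γ″ Δ Δ′} →
    Γ ≈E Γ′ → removeAt Γ′ x ≡ Γ″ → Δ ≈E Δ′ → (removeAt Γ x +E Δ) ≈E (Γ″ +E Δ′)
  removeAt-+E-cong x Γ≈ refl Δ≈ = +E.∙-cong (removeAt⁺ x Γ≈) Δ≈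

  removeAt-+E-interchange : ∀ (x : Fin (suc n)) {Γ Γ₁ Γ₂ Δ Δ₁ Δ₂} →
    Γ ≈E (Γ₁ +E Γ₂) → Δ ≈E (Δ₁ +E Δ₂) →
    (removeAt Γ x +E Δ) ≈E ((removeAt Γ₁ x +E Δ₁) +E (removeAt Γ₂ x +E Δ₂))
  removeAt-+E-interchange x {Γ₁ = Γ₁} {Γ₂} Γ≈ Δ≈ =
    +E.trans (removeAt-+E-cong x Γ≈ (removeAt-zipWith _++_ Γ₁ Γ₂ x) Δ≈) (+E.interchange _ _ _ _)

_⊢[_]_∶_#_ : ∀ {n} → Env n → ℕ → Term n → Ty → ℕ → Set
Γ ⊢[ k ] t ∶ T # s = Σ (Γ ⊢[ k ] t ∶ T) λ D → size D ≡ s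

module _ {n} {Γ : Env n} {t : Term n} {T : Ty} where

  reindex : ∀ {k k′ s s′} → k ≡ k′ → s ≡ s′ → Γ ⊢[ k ] t ∶ T # s → Γ ⊢[ k′ ] t ∶ T # s′
  reindex refl refl D = D

  ⊢-resp-≡ : ∀ {k s t′} → t ≡ t′ → Γ ⊢[ k ] t ∶ T # s → Γ ⊢[ k ] t′ ∶ T # s
  ⊢-resp-≡ refl D = D

⊢-resp-≈E : ∀ {n} {Γ Γ′ : Env n} {k t T s} → Γ′ ≈E Γ → Γ ⊢[ k ] t ∶ T # s → Γ′ ⊢[ k ] t ∶ T # s
⊢-resp-≈E Γ′≈ (ax Γ≈ l , refl)          = ax (+E.trans Γ′≈ Γ≈) l , refl
⊢-resp-≈E Γ′≈ (many[] Γ≈ , refl)        = many[] (+E.trans Γ′≈ Γ≈) , refl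
⊢-resp-≈E Γ′≈ (many∷ D E Γ≈ N≈ , refl)  = many∷ D E (+E.trans Γ′≈ Γ≈) N≈ , refl
⊢-resp-≈E Γ′≈ (lamR D l , refl)         with ⊢-resp-≈E (≈M-refl ∷ Γ′≈) (D , refl)
... | D′ , |D′| = lamR D′ l , |D′|
⊢-resp-≈E Γ′≈ (appR D E Γ≈ l , refl)    = appR D E (+E.trans Γ′≈ Γ≈) l , refl

⊢-resp-≈L : ∀ {n} {Γ : Env n} {k t L L′ s} →
  L′ ≈L L → Γ ⊢[ k ] t ∶ lin L # s → Γ ⊢[ k ] t ∶ lin L′ # s
⊢-resp-≈L L′≈ (ax Γ≈ l , refl)       = ax Γ≈ (≈L-trans L′≈ l) , refl
⊢-resp-≈L L′≈ (lamR D l , refl)      = lamR D (≈L-trans L′≈ l) , refl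
⊢-resp-≈L L′≈ (appR D E Γ≈ l , refl) = appR D E Γ≈ (≈L-trans L′≈ l) , refl

module _ {n} {Γ Γ₁ Γ₂ : Env n} {t : Term n} {k₁ k₂ s₁ s₂ : ℕ} where

  many∷# : ∀ {L M N} → Γ₁ ⊢[ k₁ ] t ∶ lin L # s₁ → Γ₂ ⊢[ k₂ ] t ∶ multi M # s₂ →
    Γ ≈E (Γ₁ +E Γ₂) → N ≈M (L ∷ M) → Γ ⊢[ k₁ + k₂ ] t ∶ multi N # (s₁ + s₂)
  many∷# (D , refl) (E , refl) Γ≈ N≈ = many∷ D E Γ≈ N≈ , refl

  appR# : ∀ {u c d M L L′} → Γ₁ ⊢[ k₁ ] t ∶ lin (M ⇒[ c ] L) # s₁ → Γ₂ ⊢[ k₂ ] u ∶ multi M # s₂ →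
    Γ ≈E (Γ₁ +E Γ₂) → L′ ≈L L → Γ ⊢[ cost c d k₁ k₂ ] app t d u ∶ lin L′ # suc (s₁ + s₂)
  appR# (D , refl) (E , refl) Γ≈ l = appR D E Γ≈ l , refl

lamR# : ∀ {n} {Γ : Env n} {M k c t L L′ s} →
  (M ∷ Γ) ⊢[ k ] t ∶ lin L # s → L′ ≈L (M ⇒[ c ] L) → Γ ⊢[ k ] lam c t ∶ lin L′ # s
lamR# (D , refl) l = lamR D l , refl

cost-interchange : ∀ c d k₁ k₁′ k₂ k₂′ →
  cost c d (k₁ + k₁′) (k₂ + k₂′) ≡ cost c d k₁ k₂ + (k₁′ + k₂′)
cost-interchange ∘ ∘ k₁ k₁′ k₂ k₂′ = ℕ+.interchange k₁ k₁′ k₂ k₂′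
cost-interchange ● ● k₁ k₁′ k₂ k₂′ = ℕ+.interchange k₁ k₁′ k₂ k₂′
cost-interchange ∘ ● k₁ k₁′ k₂ k₂′ = cong suc (ℕ+.interchange k₁ k₁′ k₂ k₂′)
cost-interchange ● ∘ k₁ k₁′ k₂ k₂′ = cong suc (ℕ+.interchange k₁ k₁′ k₂ k₂′)

ext-cong : ∀ {m n} {ρ ρ′ : Fin m → Fin n} → ρ ≗ ρ′ → ext ρ ≗ ext ρ′
ext-cong ρ≗ρ′ zero    = refl
ext-cong ρ≗ρ′ (suc j) = cong suc (ρ≗ρ′ j)

rename-cong : ∀ {m n} {ρ ρ′ : Fin m → Fin n} → ρ ≗ ρ′ → rename ρ ≗ rename ρ′
rename-cong ρ≗ρ′ (var x)     = cong var (ρ≗ρ′ x)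
rename-cong ρ≗ρ′ (lam c t)   = cong (lam c) (rename-cong (ext-cong ρ≗ρ′) t)
rename-cong ρ≗ρ′ (app t c u) =
  cong₂ (λ t′ u′ → app t′ c u′) (rename-cong ρ≗ρ′ t) (rename-cong ρ≗ρ′ u)

ext-punchIn : ∀ {n} (i : Fin (suc n)) → ext (punchIn i) ≗ punchIn (suc i)
ext-punchIn i zero    = refl
ext-punchIn i (suc j) = refl

weakening : ∀ {n} (i : Fin (suc n)) {Γ : Env n} {k t T} (D : Γ ⊢[ k ] t ∶ T) →
  insertAt Γ i [] ⊢[ k ] rename (punchIn i) t ∶ T # size D
weakening i (ax {x = y} Γ≈ l) = ax (insertAt-[]-cong i Γ≈ (insertAt-oneEnv i y _)) l , refl
weakening i (many[] Γ≈)       = many[] (insertAt-[]-cong i Γ≈ (insertAt-emptyEnv i)) , refl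
weakening i (many∷ {Γ₁ = Γ₁} {Γ₂} D E Γ≈ N≈) =
  many∷# (weakening i D) (weakening i E) (insertAt-+E i Γ₁ Γ₂ Γ≈) N≈
weakening i (lamR {t = t} D l) =
  lamR# (⊢-resp-≡ (≡.sym (rename-cong (ext-punchIn i) t)) (weakening (suc i) D)) l
weakening i (appR {Γ₁ = Γ₁} {Γ₂} D E Γ≈ l) =
  appR# (weakening i D) (weakening i E) (insertAt-+E i Γ₁ Γ₂ Γ≈) l

-- The premises of a (many) derivation of u : multi N, one for each entry of the list N in
-- order; unlike the rule it is not taken modulo ≈M, so it can be split along N₁ ++ N₂.
data Many {n} (u : Term n) : Env n → ℕ → Multi → ℕ → Set where
  nil  : ∀ {Δ} → Δ ≈E emptyEnv → Many u Δ 0 [] 0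
  cons : ∀ {Δ Δ₁ Δ₂ k k₁ k₂ s s₁ s₂ L N} →
         Δ₁ ⊢[ k₁ ] u ∶ lin L # s₁ → Many u Δ₂ k₂ N s₂ →
         Δ ≈E (Δ₁ +E Δ₂) → k ≡ k₁ + k₂ → s ≡ s₁ + s₂ → Many u Δ k (L ∷ N) s

module _ {n} {u : Term n} where

  Many-resp-↭ : ∀ {Δ k N N′ s} → N ↭ N′ → Many u Δ k N s → Many u Δ k N′ s
  Many-resp-↭ refl         F = F
  Many-resp-↭ (prep _ p)   (cons D F Δ≈ k≡ s≡) = cons D (Many-resp-↭ p F) Δ≈ k≡ s≡
  Many-resp-↭ (swap _ _ p)
    (cons {k₁ = k₁} {s₁ = s₁} D₁
      (cons {k₁ = k₂} {k₃} {s₁ = s₂} {s₃} D₂ F Δ′≈ refl refl) Δ≈ refl refl) =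
    cons D₂ (cons D₁ (Many-resp-↭ p F) +E.refl refl refl)
      (+E.trans (+E.trans Δ≈ (+E.∙-congˡ Δ′≈)) (+E.x∙yz≈y∙xz _ _ _))
      (ℕ+.x∙yz≈y∙xz k₁ k₂ k₃) (ℕ+.x∙yz≈y∙xz s₁ s₂ s₃)
  Many-resp-↭ (trans p q)  F = Many-resp-↭ q (Many-resp-↭ p F)

  Many-resp-≈* : ∀ {Δ k N N′ s} → N ≈* N′ → Many u Δ k N s → Many u Δ k N′ s
  Many-resp-≈* []      F                   = F
  Many-resp-≈* (l ∷ q) (cons D F Δ≈ k≡ s≡) =
    cons (⊢-resp-≈L (≈L-sym l) D) (Many-resp-≈* q F) Δ≈ k≡ s≡

  Many-resp-≈M : ∀ {Δ k N N′ s} → N ≈M N′ → Many u Δ k N s → Many u Δ k N′ s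
  Many-resp-≈M (perm≈ p q) F = Many-resp-≈* q (Many-resp-↭ p F)

  toMany : ∀ {Δ k N} (E : Δ ⊢[ k ] u ∶ multi N) → Many u Δ k N (size E)
  toMany (many[] Δ≈)        = nil Δ≈
  toMany (many∷ D E Δ≈ N≈) = Many-resp-≈M (≈M-sym N≈) (cons (D , refl) (toMany E) Δ≈ refl refl)

  Many-singleton : ∀ {Δ k L s} → Many u Δ k (L ∷ []) s → Δ ⊢[ k ] u ∶ lin L # s
  Many-singleton (cons D (nil Δ′≈) Δ≈ refl refl) =
    reindex (≡.sym (+-identityʳ _)) (≡.sym (+-identityʳ _))
      (⊢-resp-≈E (+E.trans (+E.trans Δ≈ (+E.∙-congˡ Δ′≈)) (+E.identityʳ _)) D)

  Many-weaken : ∀ {Δ k N s} → Many u Δ k N s → Many (rename suc u) ([] ∷ Δ) k N s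
  Many-weaken (nil Δ≈)                   = nil (≈M-refl ∷ Δ≈)
  Many-weaken (cons (D , refl) F Δ≈ k≡ s≡) =
    cons (weakening zero D) (Many-weaken F) (≈M-refl ∷ Δ≈) k≡ s≡

  record Split (Δ : Env n) (k : ℕ) (N₁ N₂ : Multi) (s : ℕ) : Set where
    constructor splitting
    field
      {Δ₁ Δ₂}       : Env n
      {k₁ k₂ s₁ s₂} : ℕ
      left  : Many u Δ₁ k₁ N₁ s₁
      right : Many u Δ₂ k₂ N₂ s₂
      Δ≈    : Δ ≈E (Δ₁ +E Δ₂)
      k≡    : k ≡ k₁ + k₂
      s≡    : s ≡ s₁ + s₂

  split : ∀ {Δ k N₂ s} N₁ → Many u Δ k (N₁ ++ N₂) s → Split Δ k N₁ N₂ s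
  split []       F = splitting (nil +E.refl) F (+E.sym (+E.identityˡ _)) refl refl
  split (L ∷ N₁) (cons {k₁ = k} {s₁ = s} D F Δ≈ refl refl) with split N₁ F
  ... | splitting {k₁ = k₁} {k₂} {s₁} {s₂} F₁ F₂ Δ′≈ refl refl =
    splitting (cons D F₁ +E.refl refl refl) F₂
      (+E.trans (+E.trans Δ≈ (+E.∙-congˡ Δ′≈)) (+E.sym (+E.assoc _ _ _)))
      (≡.sym (+-assoc k k₁ k₂)) (≡.sym (+-assoc s s₁ s₂))

  Many-lookup : ∀ {m} {Γ Γ′ : Env m} {N Δ k s} x →
    Γ ≈E Γ′ → lookup Γ′ x ≡ N → Many u Δ k (lookup Γ x) s → Many u Δ k N s
  Many-lookup x Γ≈ refl = Many-resp-≈M (VecPW.lookup Γ≈ x)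

  split-lookup : ∀ {m} {Γ Γ₁ Γ₂ : Env m} {Δ k s} → Γ ≈E (Γ₁ +E Γ₂) → ∀ x →
    Many u Δ k (lookup Γ x) s → Split Δ k (lookup Γ₁ x) (lookup Γ₂ x) s
  split-lookup {Γ₁ = Γ₁} {Γ₂} Γ≈ x F =
    split (lookup Γ₁ x) (Many-lookup x Γ≈ (Vec.lookup-zipWith _++_ x Γ₁ Γ₂) F)

exts-cong : ∀ {m n} {σ σ′ : Fin m → Term n} → σ ≗ σ′ → exts σ ≗ exts σ′
exts-cong σ≗σ′ zero    = refl
exts-cong σ≗σ′ (suc j) = cong (rename suc) (σ≗σ′ j)

subst-cong : ∀ {m n} {σ σ′ : Fin m → Term n} → σ ≗ σ′ → subst σ ≗ subst σ′
subst-cong σ≗σ′ (var x)     = σ≗σ′ x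
subst-cong σ≗σ′ (lam c t)   = cong (lam c) (subst-cong (exts-cong σ≗σ′) t)
subst-cong σ≗σ′ (app t c u) =
  cong₂ (λ t′ u′ → app t′ c u′) (subst-cong σ≗σ′ t) (subst-cong σ≗σ′ u)

exts-single : ∀ {n} (x : Fin (suc n)) (u : Term n) →
  exts (single x u) ≗ single (suc x) (rename suc u)
exts-single x u zero = refl
exts-single x u (suc j) with x ≟ j
... | yes _   = refl
... | no x≢j  = cong (var ∘′ suc) (punchOut-cong x refl)

substitution : ∀ {n} {Γ : Env (suc n)} {k t T} (D : Γ ⊢[ k ] t ∶ T) (x : Fin (suc n))
  {u : Term n} {Δ k′ s} →
  Many u Δ k′ (lookup Γ x) s → (removeAt Γ x +E Δ) ⊢[ k + k′ ] t [ x := u ] ∶ T # (size D + s)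
substitution (ax {x = y} Γ≈ l) x F with x ≟ y
... | yes refl =
  ⊢-resp-≈E (+E.trans (removeAt-+E-cong x Γ≈ (removeAt-oneEnv x _) +E.refl) (+E.identityˡ _))
    (⊢-resp-≈L l (Many-singleton (Many-lookup x Γ≈ (lookup-oneEnv x _) F)))
... | no x≢y with Many-lookup x Γ≈ (lookup-oneEnv′ _ x≢y) F
...   | nil Δ≈ =
  ax (+E.trans (removeAt-+E-cong x Γ≈ (removeAt-oneEnv′ _ x≢y) Δ≈) (+E.identityʳ _)) l , refl
substitution (many[] Γ≈) x F with Many-lookup x Γ≈ (lookup-emptyEnv x) F
... | nil Δ≈ =
  many[] (+E.trans (removeAt-+E-cong x Γ≈ (removeAt-emptyEnv x) Δ≈) (+E.identityʳ _)) , refl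
substitution (many∷ {k₁ = k₁} {k₂} D E Γ≈ N≈) x F with split-lookup Γ≈ x F
... | splitting {k₁ = k₁′} {k₂′} {s₁} {s₂} F₁ F₂ Δ≈ refl refl =
  reindex (ℕ+.interchange k₁ k₁′ k₂ k₂′) (ℕ+.interchange (size D) s₁ (size E) s₂)
    (many∷# (substitution D x F₁) (substitution E x F₂) (removeAt-+E-interchange x Γ≈ Δ≈) N≈)
substitution (appR {k₁ = k₁} {k₂} {c = c} {d} D E Γ≈ l) x F with split-lookup Γ≈ x F
... | splitting {k₁ = k₁′} {k₂′} {s₁} {s₂} F₁ F₂ Δ≈ refl refl =
  reindex (cost-interchange c d k₁ k₁′ k₂ k₂′) (cong suc (ℕ+.interchange (size D) s₁ (size E) s₂))
    (appR# (substitution D x F₁) (substitution E x F₂) (removeAt-+E-interchange x Γ≈ Δ≈) l)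
substitution {Γ = _ ∷ _} (lamR {M = M} {t = t} D l) x {u} F =
  lamR# (⊢-resp-≡ (≡.sym (subst-cong (exts-single x u) t))
          (⊢-resp-≈E (≈M-reflexive (≡.sym (List.++-identityʳ M)) ∷ +E.refl)
            (substitution D (suc x) (Many-weaken F)))) l

lemma8 : ∀ {n : ℕ} (t : Term (suc n)) (u : Term n) (x : Fin (suc n))
    (M : Multi) (T : Ty) (Γ Δ : Env n) (k k' : ℕ)
    (D : (Γ ,[ x ]∶ M) ⊢[ k ] t ∶ T) (E : Δ ⊢[ k' ] u ∶ multi M) →
    Σ ((Γ +E Δ) ⊢[ k + k' ] (t [ x := u ]) ∶ T)
    (λ D' → size D' ≡ size D + size E)
lemma8 t u x M T Γ Δ k k' D E =
  ≡.subst (λ Γ′ → (Γ′ +E Δ) ⊢[ k + k' ] t [ x := u ] ∶ T # (size D + size E))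
    (Vec.removeAt-insertAt Γ x M)
    (substitution D x (Many-resp-≈M (≈M-reflexive (≡.sym (Vec.insertAt-lookup Γ x M))) (toMany E)))
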